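{- Let $n\ge5$ be odd, $T=\langle n,3n-2,3n-1\rangle$, $\mathrm F(T)=\max(\mathbb Z\setminus T)$ and $S=T\cup\{\mathrm F(T)\}$, and let $i$ be an integer with $2\le i\le\frac{n-1}{2}$. Then the set of minimal elements of $\mathrm{nf}(M_i)=\{\mathrm{nf}(s): s\in M_i\}$ with respect to the componentwise partial order on $\mathbb N^3$ is $\left\{\left(\frac{3n-5}{2},i-2,1\right),\ (3(i-1),i-1,0)\right\}$.
   Context: For $m\in S\setminus\{0\}$, $\mathrm{Ap}(S,m)=\{s\in S: s-m\notin S\}$. For $s\in\mathrm{Ap}(S,\mathrm F(T))$ (such $s$ lie in $T$), $\mathsf Z(s)=\{(x,y,z)\in\mathbb N^3: xn+y(3n-2)+z(3n-1)=s\}$, and $\mathrm{nf}(s)$ is the unique element $(x,y,z)\in\mathsf Z(s)$ with $z<2$, $y<\frac{n+1}{2}$, $x<\frac{3n-1}{2}$. $M_i=\{s\in\mathrm{Ap}(S,\mathrm F(T)): \#\mathsf Z(s)=i\}$. -}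

module Defs where

open import Data.Nat using (ℕ; _+_; _*_; _∸_; _≤_; _<_)
open import Data.Product using (Σ; ∃; _×_; _,_)
open import Data.Sum using (_⊎_)
open import Data.Fin using (Fin)
open import Relation.Nullary using (¬_)
open import Relation.Binary.PropositionalEquality using (_≡_)
open import Function.Bundles using (_↔_)
open import Data.Nat.DivMod using (_/_)

Triple : Set
Triple = ℕ × ℕ × ℕ

fact : ℕ → Triple → ℕ
fact n (x , y , z) = x * n + y * (3 * n ∸ 2) + z * (3 * n ∸ 1)

Z : ℕ → ℕ → Set
Z n s = Σ Triple (λ t → fact n t ≡ s)

InT : ℕ → ℕ → Set
InT n s = ∃ λ t → fact n t ≡ s

IsFrobeniusT : ℕ → ℕ → Set
IsFrobeniusT n f = ¬ InT n f × (∀ m → f < m → InT n m)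

InS : ℕ → ℕ → ℕ → Set
InS n f s = InT n s ⊎ s ≡ f

-- s ∈ Ap(S, f) : s ∈ S and s - f ∉ S (s - f < 0 is never in S)
InAp : ℕ → ℕ → ℕ → Set
InAp n f s = InS n f s × (f ≤ s → ¬ InS n f (s ∸ f))

NumFact : ℕ → ℕ → ℕ → Set
NumFact n s i = Fin i ↔ Z n s

InM : ℕ → ℕ → ℕ → ℕ → Set
InM n f i s = InAp n f s × NumFact n s i

IsNF : ℕ → ℕ → Triple → Set
IsNF n s (x , y , z) =
  fact n (x , y , z) ≡ s × z < 2 × y < (n + 1) / 2 × x < (3 * n ∸ 1) / 2

InNfM : ℕ → ℕ → ℕ → Triple → Set
InNfM n f i t = ∃ λ s → InM n f i s × IsNF n s t

_≤₃_ : Triple → Triple → Set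
(a , b , c) ≤₃ (a' , b' , c') = a ≤ a' × b ≤ b' × c ≤ c'

Minimal : (Triple → Set) → Triple → Set
Minimal P t = P t × (∀ u → P u → u ≤₃ t → u ≡ t)

-- Write n = 2h + 5. Since 3n − 2 and 3n − 1 fall short of 3n by 2 and 1, a factorization
-- (p, q, r) of s satisfies s + (2q + r) = n (p + 3q + 3r). Writing s + d = nP with d < n,
-- every factorization of s has defect 2q + r = d + nm and height p + 3q + 3r = P + m for
-- some m. As 2·height ≥ 3·defect + 3·(defect mod 2), this decides membership in T, which
-- identifies F(T) and shows that both candidates lie in Ap(S, F(T)). It also shows that the
-- factorizations of an element with normal form (x, y, z) arise from it by j ≤ min(y, ⌊x/3⌋)
-- trades 3·n + (3n − 2) = 2·(3n − 1), plus one exchange (3h + 5)·n + (3n − 1) = (h + 3)·(3n − 2)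
-- when z = 1 and x ≥ 3h + 5. Hence #Z = 1 + min(y, ⌊x/3⌋) + [exchange], so every element of
-- nf(M_i) lies above ((3n − 5)/2, i − 2, 1) or above (3(i − 1), i − 1, 0).

module Submission where

open import Defs
open import Data.Nat using (ℕ; zero; suc; _⊓_; _+_; _*_; _∸_; _≤_; _<_; _%_; z≤n; s≤s; s≤s⁻¹; NonZero; >-nonZero)
open import Data.Nat.DivMod using (_/_; m*n/n≡m; m/n*n≤m; /-monoˡ-≤; m%n≤m; m%n<n; m≡m%n+[m/n]*n; [m+kn]%n≡m%n)
open import Data.Nat.Divisibility using (_∣_; ∣m+n∣m⇒∣n; m∣m*n)
open import Data.Nat.Properties
open import Data.Nat.Tactic.RingSolver using (solve-∀)
open import Data.Product using (Σ; ∃; _×_; _,_; proj₁; proj₂)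
open import Data.Sum using (_⊎_; inj₁; inj₂; [_,_]′)
open import Data.Empty using (⊥-elim)
open import Data.Fin using (Fin; zero; toℕ; fromℕ<)
open import Data.Fin.Properties using (toℕ<n; toℕ-fromℕ<; fromℕ<-toℕ; cantor-schröder-bernstein; +↔⊎)
open import Relation.Binary.PropositionalEquality
open import Relation.Nullary using (¬_; yes; no; _×-dec_)
open import Relation.Binary.Definitions using (tri<; tri≈; tri>)
open import Function.Bundles using (_⇔_; mk⇔; Equivalence; _↔_; Injection; mk↔ₛ′)
open import Function.Properties.Inverse using (↔-sym; ↔-trans; ↔⇒↣)
open import Data.Sum.Function.Propositional using (_⊎-↔_)

m+k≡n⇒m≤n : ∀ {m n} k → m + k ≡ n → m ≤ n
m+k≡n⇒m≤n k refl = m≤m+n _ k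

m+n*0≡m : ∀ m n → m + n * 0 ≡ m
m+n*0≡m m n = trans (cong (m +_) (*-zeroʳ n)) (+-identityʳ m)

height : Triple → ℕ
height (p , q , r) = p + 3 * q + 3 * r

defect : Triple → ℕ
defect (p , q , r) = 2 * q + r

fact+defect≡n*height : ∀ n → 1 ≤ n → ∀ t → fact n t + defect t ≡ n * height t
fact+defect≡n*height (suc k) _ (p , q , r) = begin
  p * suc k + q * (3 * suc k ∸ 2) + r * (3 * suc k ∸ 1) + (2 * q + r)
    ≡⟨ cong₂ (λ b c → p * suc k + q * b + r * c + (2 * q + r)) (cong (_∸ 2) (split₂ k)) (cong (_∸ 1) (split₁ k)) ⟩
  p * suc k + q * (1 + 3 * k) + r * (2 + 3 * k) + (2 * q + r)
    ≡⟨ expand p q r k ⟩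
  suc k * (p + 3 * q + 3 * r) ∎
  where
  open ≡-Reasoning
  split₂ : ∀ k → 3 * suc k ≡ 2 + (1 + 3 * k)
  split₂ = solve-∀
  split₁ : ∀ k → 3 * suc k ≡ 1 + (2 + 3 * k)
  split₁ = solve-∀
  expand : ∀ p q r k → p * suc k + q * (1 + 3 * k) + r * (2 + 3 * k) + (2 * q + r) ≡ suc k * (p + 3 * q + 3 * r)
  expand = solve-∀

2*height≡ : ∀ p q r → 2 * height (p , q , r) ≡ 2 * p + 3 * defect (p , q , r) + 3 * r
2*height≡ = identity
  where identity : ∀ p q r → 2 * (p + 3 * q + 3 * r) ≡ 2 * p + 3 * (2 * q + r) + 3 * r
        identity = solve-∀

defect-bound : ∀ t → 3 * defect t + 3 * (defect t % 2) ≤ 2 * height t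
defect-bound (p , q , r) = begin
  3 * (2 * q + r) + 3 * ((2 * q + r) % 2)
    ≡⟨ cong (λ d → 3 * (2 * q + r) + 3 * (d % 2)) (trans (+-comm (2 * q) r) (cong (r +_) (*-comm 2 q))) ⟩
  3 * (2 * q + r) + 3 * ((r + q * 2) % 2)
    ≡⟨ cong (λ d → 3 * (2 * q + r) + 3 * d) ([m+kn]%n≡m%n r q 2) ⟩
  3 * (2 * q + r) + 3 * (r % 2)
    ≤⟨ +-monoʳ-≤ (3 * (2 * q + r)) (*-monoʳ-≤ 3 (m%n≤m r 2)) ⟩
  3 * (2 * q + r) + 3 * r
    ≤⟨ +-monoˡ-≤ (3 * r) (m≤n+m _ (2 * p)) ⟩
  2 * p + 3 * (2 * q + r) + 3 * r
    ≡⟨ 2*height≡ p q r ⟨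
  2 * height (p , q , r) ∎
  where open ≤-Reasoning

complement-lift : ∀ {n s D₀ P₀ D P} → D₀ < n → s + D₀ ≡ n * P₀ → s + D ≡ n * P →
                  ∃ λ m → P ≡ P₀ + m × D ≡ D₀ + n * m
complement-lift {n} {s} {D₀} {P₀} {D} {P} D₀<n e₀ e with P₀ ≤? P
... | yes P₀≤P = P ∸ P₀ , sym (m+[n∸m]≡n P₀≤P) , +-cancelˡ-≡ s D (D₀ + n * (P ∸ P₀)) (begin
  s + D                  ≡⟨ e ⟩
  n * P                  ≡⟨ cong (n *_) (m+[n∸m]≡n P₀≤P) ⟨
  n * (P₀ + (P ∸ P₀))    ≡⟨ *-distribˡ-+ n P₀ (P ∸ P₀) ⟩
  n * P₀ + n * (P ∸ P₀)  ≡⟨ cong (_+ n * (P ∸ P₀)) e₀ ⟨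
  s + D₀ + n * (P ∸ P₀)  ≡⟨ +-assoc s D₀ _ ⟩
  s + (D₀ + n * (P ∸ P₀)) ∎)
  where open ≡-Reasoning
... | no P₀≰P = ⊥-elim (<⇒≱ D₀<n (+-cancelˡ-≤ s n D₀ (begin
  s + n          ≤⟨ +-monoʳ-≤ s (m≤n+m n D) ⟩
  s + (D + n)    ≡⟨ +-assoc s D n ⟨
  s + D + n      ≡⟨ cong (_+ n) e ⟩
  n * P + n      ≡⟨ +-comm (n * P) n ⟩
  n + n * P      ≡⟨ *-suc n P ⟨
  n * suc P      ≤⟨ *-monoʳ-≤ n (≰⇒> P₀≰P) ⟩
  n * P₀         ≡⟨ e₀ ⟨
  s + D₀         ∎)))
  where open ≤-Reasoning

complement-unique : ∀ {n s D₀ P₀ D₁ P₁} → D₀ < n → D₁ < n → s + D₀ ≡ n * P₀ → s + D₁ ≡ n * P₁ →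
                    D₀ ≡ D₁ × P₀ ≡ P₁
complement-unique {n} {D₀ = D₀} {P₀} {D₁} D₀<n D₁<n e₀ e₁ with complement-lift D₀<n e₀ e₁
... | zero , P≡ , D≡ = sym (trans D≡ (m+n*0≡m D₀ n)) , sym (trans P≡ (+-identityʳ P₀))
... | suc m , _ , D≡ = ⊥-elim (<⇒≱ D₁<n (begin
  n              ≤⟨ m≤m*n n (suc m) ⟩
  n * suc m      ≤⟨ m≤n+m (n * suc m) D₀ ⟩
  D₀ + n * suc m ≡⟨ D≡ ⟨
  D₁             ∎))
  where open ≤-Reasoning

factorization-lift : ∀ {n s D₀ P₀} → 1 ≤ n → D₀ < n → s + D₀ ≡ n * P₀ → ∀ t → fact n t ≡ s →
                     ∃ λ m → height t ≡ P₀ + m × defect t ≡ D₀ + n * m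
factorization-lift {n} n≥1 D₀<n e t refl = complement-lift D₀<n e (fact+defect≡n*height n n≥1 t)

∉T-criterion : ∀ {n w D₀ P₀} → 2 ≤ n → D₀ < n → w + D₀ ≡ n * P₀ →
               2 * P₀ < 3 * D₀ + 3 * (D₀ % 2) → ¬ InT n w
∉T-criterion {n} {w} {D₀} {P₀} n≥2 D₀<n e small (t , refl)
  with factorization-lift (≤-trans (s≤s z≤n) n≥2) D₀<n e t refl
... | zero , H≡ , D≡ = <⇒≱ small (subst₂ (λ D P → 3 * D + 3 * (D % 2) ≤ 2 * P)
        (trans D≡ (m+n*0≡m D₀ n)) (trans H≡ (+-identityʳ P₀)) (defect-bound t))
... | suc m , H≡ , D≡ = <⇒≱ (+-monoˡ-< (2 * suc m) small) (begin
  3 * D₀ + 3 * (D₀ % 2) + 2 * suc m  ≤⟨ +-monoˡ-≤ (2 * suc m) (+-monoʳ-≤ (3 * D₀) (*-monoʳ-≤ 3 (s≤s⁻¹ (m%n<n D₀ 2)))) ⟩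
  3 * D₀ + 3 * 1 + 2 * suc m         ≤⟨ ≤-reflexive (+-assoc (3 * D₀) 3 _) ⟩
  3 * D₀ + (3 * 1 + 2 * suc m)       ≤⟨ +-monoʳ-≤ (3 * D₀) (3+2[1+m]≤3*2*[1+m] m) ⟩
  3 * D₀ + 3 * (2 * suc m)           ≤⟨ +-monoʳ-≤ (3 * D₀) (*-monoʳ-≤ 3 (*-monoˡ-≤ (suc m) n≥2)) ⟩
  3 * D₀ + 3 * (n * suc m)           ≡⟨ *-distribˡ-+ 3 D₀ _ ⟨
  3 * (D₀ + n * suc m)               ≡⟨ cong (3 *_) D≡ ⟨
  3 * defect t                       ≤⟨ m≤m+n _ _ ⟩
  3 * defect t + 3 * (defect t % 2)  ≤⟨ defect-bound t ⟩
  2 * height t                       ≡⟨ cong (2 *_) H≡ ⟩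
  2 * (P₀ + suc m)                   ≡⟨ *-distribˡ-+ 2 P₀ (suc m) ⟩
  2 * P₀ + 2 * suc m                 ∎)
  where
  open ≤-Reasoning
  3+2[1+m]≤3*2*[1+m] : ∀ m → 3 * 1 + 2 * suc m ≤ 3 * (2 * suc m)
  3+2[1+m]≤3*2*[1+m] m = m+k≡n⇒m≤n (1 + 4 * m) (identity m)
    where identity : ∀ m → 3 * 1 + 2 * suc m + (1 + 4 * m) ≡ 3 * (2 * suc m)
          identity = solve-∀

round-up : ∀ {n} → 1 ≤ n → ∀ m → ∃ λ d → ∃ λ P → d < n × m + d ≡ n * P
round-up {n} n≥1 m = split (m % n) (m / n) (m≡m%n+[m/n]*n m n) (m%n<n m n)
  where
  instance
    n≢0 : NonZero n
    n≢0 = >-nonZero n≥1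
  split : ∀ r q → m ≡ r + q * n → r < n → ∃ λ d → ∃ λ P → d < n × m + d ≡ n * P
  split zero q m≡ _ = 0 , q , n≥1 , trans (+-identityʳ m) (trans m≡ (*-comm q n))
  split (suc r) q m≡ 1+r<n = n ∸ suc r , suc q , ∸-monoʳ-< {n} {suc r} {0} (s≤s z≤n) (<⇒≤ 1+r<n) , (begin
    m + (n ∸ suc r)             ≡⟨ cong (_+ (n ∸ suc r)) m≡ ⟩
    suc r + q * n + (n ∸ suc r) ≡⟨ swap (suc r) (q * n) (n ∸ suc r) ⟩
    suc r + (n ∸ suc r) + q * n ≡⟨ cong (_+ q * n) (m+[n∸m]≡n (<⇒≤ 1+r<n)) ⟩
    n + q * n                   ≡⟨ cong (n +_) (*-comm q n) ⟩
    n + n * q                   ≡⟨ *-suc n q ⟨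
    n * suc q                   ∎)
    where
    open ≡-Reasoning
    swap : ∀ a b c → a + b + c ≡ a + c + b
    swap = solve-∀

InT-from-complement : ∀ {n m} → 1 ≤ n → ∀ t → m + defect t ≡ n * height t → InT n m
InT-from-complement {n} {m} n≥1 t e =
  t , +-cancelʳ-≡ (defect t) (fact n t) m (trans (fact+defect≡n*height n n≥1 t) (sym e))

N : ℕ → ℕ
N h = 5 + 2 * h

-- F(T) = (h + 1)(3n − 2) + (3n − 1) − n, see frobenius+N
frobenius : ℕ → ℕ
frobenius h = 22 + 23 * h + 6 * (h * h)

N≡1+2[2+h] : ∀ h → N h ≡ 1 + 2 * (2 + h)
N≡1+2[2+h] = identity
  where identity : ∀ h → 5 + 2 * h ≡ 1 + 2 * (2 + h)
        identity = solve-∀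

fact-N : ∀ h x y z → fact (N h) (x , y , z) ≡ x * N h + y * (13 + 6 * h) + z * (14 + 6 * h)
fact-N h x y z = cong₂ (λ b c → x * N h + y * b + z * c) (cong (_∸ 2) (split₂ h)) (cong (_∸ 1) (split₁ h))
  where
  split₂ : ∀ h → 3 * (5 + 2 * h) ≡ 2 + (13 + 6 * h)
  split₂ = solve-∀
  split₁ : ∀ h → 3 * (5 + 2 * h) ≡ 1 + (14 + 6 * h)
  split₁ = solve-∀

frobenius-complement : ∀ h → frobenius h + (3 + 2 * h) ≡ N h * (5 + 3 * h)
frobenius-complement = identity
  where identity : ∀ h → 22 + 23 * h + 6 * (h * h) + (3 + 2 * h) ≡ (5 + 2 * h) * (5 + 3 * h)
        identity = solve-∀

frobenius+N : ∀ h → frobenius h + N h ≡ fact (N h) (0 , 1 + h , 1)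
frobenius+N h = trans (identity h) (sym (fact-N h 0 (1 + h) 1))
  where identity : ∀ h → 22 + 23 * h + 6 * (h * h) + (5 + 2 * h) ≡ 0 * (5 + 2 * h) + (1 + h) * (13 + 6 * h) + 1 * (14 + 6 * h)
        identity = solve-∀

[1+2k]%2≡1 : ∀ k → (1 + 2 * k) % 2 ≡ 1
[1+2k]%2≡1 k = trans (cong (λ j → (1 + j) % 2) (*-comm 2 k)) ([m+kn]%n≡m%n 1 k 2)

3+2h<N : ∀ h → 3 + 2 * h < N h
3+2h<N h = m+k≡n⇒m≤n 1 (identity h)
  where identity : ∀ h → suc (3 + 2 * h) + 1 ≡ 5 + 2 * h
        identity = solve-∀

frobenius∉T : ∀ h → ¬ InT (N h) (frobenius h)
frobenius∉T h = ∉T-criterion {D₀ = 3 + 2 * h} {5 + 3 * h} (s≤s (s≤s z≤n)) (3+2h<N h) (frobenius-complement h) small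
  where
  odd : (3 + 2 * h) % 2 ≡ 1
  odd = trans (cong (_% 2) (3+2h≡ h)) ([1+2k]%2≡1 (1 + h))
    where 3+2h≡ : ∀ h → 3 + 2 * h ≡ 1 + 2 * (1 + h)
          3+2h≡ = solve-∀
  small : 2 * (5 + 3 * h) < 3 * (3 + 2 * h) + 3 * ((3 + 2 * h) % 2)
  small = subst (λ e → 2 * (5 + 3 * h) < 3 * (3 + 2 * h) + 3 * e) (sym odd) (m+k≡n⇒m≤n 1 (identity h))
    where identity : ∀ h → suc (2 * (5 + 3 * h)) + 1 ≡ 3 * (3 + 2 * h) + 3 * 1
          identity = solve-∀

fact-0qr≤fact-0[1+h]1 : ∀ h q r → r < 2 → 2 * q + r < N h → fact (N h) (0 , q , r) ≤ fact (N h) (0 , 1 + h , 1)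
fact-0qr≤fact-0[1+h]1 h q r r<2 2q+r<N = begin
  fact (N h) (0 , q , r)                              ≡⟨ fact-N h 0 q r ⟩
  0 * N h + q * (13 + 6 * h) + r * (14 + 6 * h)       ≤⟨ bound r r<2 (subst (2 * q + r <_) (N≡1+2[2+h] h) 2q+r<N) ⟩
  0 * N h + (1 + h) * (13 + 6 * h) + 1 * (14 + 6 * h) ≡⟨ fact-N h 0 (1 + h) 1 ⟨
  fact (N h) (0 , 1 + h , 1)                          ∎
  where
  open ≤-Reasoning
  bound : ∀ r → r < 2 → 2 * q + r < 1 + 2 * (2 + h) →
          0 * N h + q * (13 + 6 * h) + r * (14 + 6 * h) ≤ 0 * N h + (1 + h) * (13 + 6 * h) + 1 * (14 + 6 * h)
  bound 0 _ 2q<1+2[2+h] = begin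
    q * (13 + 6 * h) + 0 * (14 + 6 * h)           ≡⟨ +-identityʳ _ ⟩
    q * (13 + 6 * h)                             ≤⟨ *-monoˡ-≤ (13 + 6 * h) q≤2+h ⟩
    (2 + h) * (13 + 6 * h)                       ≤⟨ m+k≡n⇒m≤n 1 (identity h) ⟩
    (1 + h) * (13 + 6 * h) + 1 * (14 + 6 * h)     ∎
    where
    q≤2+h : q ≤ 2 + h
    q≤2+h = *-cancelˡ-≤ 2 (s≤s⁻¹ (subst (_< 1 + 2 * (2 + h)) (+-identityʳ (2 * q)) 2q<1+2[2+h]))
    identity : ∀ h → (2 + h) * (13 + 6 * h) + 1 ≡ (1 + h) * (13 + 6 * h) + 1 * (14 + 6 * h)
    identity = solve-∀
  bound 1 _ 2q+1<1+2[2+h] = +-monoˡ-≤ (1 * (14 + 6 * h)) (*-monoˡ-≤ (13 + 6 * h) q≤1+h)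
    where
    q≤1+h : q ≤ 1 + h
    q≤1+h = s≤s⁻¹ (*-cancelˡ-< 2 q (2 + h) (s≤s⁻¹ (subst (_< 1 + 2 * (2 + h)) (+-comm (2 * q) 1) 2q+1<1+2[2+h])))
  bound (suc (suc _)) (s≤s (s≤s ())) _

above-frobenius∈T : ∀ h m → frobenius h < m → InT (N h) m
above-frobenius∈T h m F<m with round-up {N h} (s≤s z≤n) m
... | d , P , d<N , m+d≡N*P = InT-from-complement (s≤s z≤n) t (subst₂ (λ e H → m + e ≡ N h * H) (sym 2q+r≡d) (sym height-t≡P) m+d≡N*P)
  where
  q = d / 2
  r = d % 2
  2q+r≡d : 2 * q + r ≡ d
  2q+r≡d = trans (+-comm (2 * q) r) (trans (cong (r +_) (*-comm 2 q)) (sym (m≡m%n+[m/n]*n d 2)))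
  3q+3r<1+P : N h * (3 * q + 3 * r) < N h * suc P
  3q+3r<1+P = begin-strict
    N h * (3 * q + 3 * r)             ≡⟨ fact+defect≡n*height (N h) (s≤s z≤n) (0 , q , r) ⟨
    fact (N h) (0 , q , r) + (2 * q + r) ≤⟨ +-monoˡ-≤ (2 * q + r) (fact-0qr≤fact-0[1+h]1 h q r (m%n<n d 2) (subst (_< N h) (sym 2q+r≡d) d<N)) ⟩
    fact (N h) (0 , 1 + h , 1) + (2 * q + r) ≡⟨ cong (_+ (2 * q + r)) (frobenius+N h) ⟨
    frobenius h + N h + (2 * q + r)   <⟨ +-monoˡ-< (2 * q + r) (+-monoˡ-< (N h) F<m) ⟩
    m + N h + (2 * q + r)             ≡⟨ cong (m + N h +_) 2q+r≡d ⟩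
    m + N h + d                       ≡⟨ rearrange m (N h) d ⟩
    N h + (m + d)                     ≡⟨ cong (N h +_) m+d≡N*P ⟩
    N h + N h * P                     ≡⟨ *-suc (N h) P ⟨
    N h * suc P                       ∎
    where
    open ≤-Reasoning
    rearrange : ∀ a b c → a + b + c ≡ b + (a + c)
    rearrange = solve-∀
  3q+3r≤P : 3 * q + 3 * r ≤ P
  3q+3r≤P = s≤s⁻¹ (*-cancelˡ-< (N h) _ _ 3q+3r<1+P)
  t : Triple
  t = (P ∸ (3 * q + 3 * r) , q , r)
  height-t≡P : height t ≡ P
  height-t≡P = trans (+-assoc (P ∸ (3 * q + 3 * r)) (3 * q) (3 * r)) (m∸n+n≡m 3q+3r≤P)

frobenius-unique : ∀ h f → IsFrobeniusT (N h) f → f ≡ frobenius h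
frobenius-unique h f (f∉T , above-f∈T) with <-cmp f (frobenius h)
... | tri< f<F _ _ = ⊥-elim (frobenius∉T h (above-f∈T (frobenius h) f<F))
... | tri≈ _ f≡F _ = f≡F
... | tri> _ _ F<f = ⊥-elim (f∉T (above-frobenius∈T h f F<f))

complement-of-difference : ∀ {n w u s Dᵤ Pᵤ Dₛ Pₛ D} → 1 ≤ n →
                           w + u ≡ s → u + Dᵤ ≡ n * Pᵤ → s + Dₛ ≡ n * Pₛ → Dₛ + n ≡ Dᵤ + D →
                           ∃ λ P → w + D ≡ n * P × Pᵤ + P ≡ suc Pₛ
complement-of-difference {n} {w} {u} {s} {Dᵤ} {Pᵤ} {Dₛ} {Pₛ} {D} n≥1 w+u≡s eᵤ eₛ D≡ =
  P , trans w+D≡P*n (*-comm P n) , *-cancelˡ-≡ _ _ n (begin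
    n * (Pᵤ + P)       ≡⟨ *-distribˡ-+ n Pᵤ P ⟩
    n * Pᵤ + n * P     ≡⟨ cong (n * Pᵤ +_) (trans (*-comm n P) (sym w+D≡P*n)) ⟩
    n * Pᵤ + (w + D)   ≡⟨ sum≡ ⟩
    n * suc Pₛ         ∎)
  where
  open ≡-Reasoning
  instance
    n≢0 : NonZero n
    n≢0 = >-nonZero n≥1
  rearrange : ∀ u Dᵤ w D → u + Dᵤ + (w + D) ≡ w + u + (Dᵤ + D)
  rearrange = solve-∀
  sum≡ : n * Pᵤ + (w + D) ≡ n * suc Pₛ
  sum≡ = begin
    n * Pᵤ + (w + D)   ≡⟨ cong (_+ (w + D)) eᵤ ⟨
    u + Dᵤ + (w + D)   ≡⟨ rearrange u Dᵤ w D ⟩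
    w + u + (Dᵤ + D)   ≡⟨ cong₂ _+_ w+u≡s (sym D≡) ⟩
    s + (Dₛ + n)       ≡⟨ +-assoc s Dₛ n ⟨
    s + Dₛ + n         ≡⟨ cong (_+ n) eₛ ⟩
    n * Pₛ + n         ≡⟨ +-comm (n * Pₛ) n ⟩
    n + n * Pₛ         ≡⟨ *-suc n Pₛ ⟨
    n * suc Pₛ         ∎
  n∣w+D : n ∣ w + D
  n∣w+D = ∣m+n∣m⇒∣n (subst (n ∣_) (sym sum≡) (m∣m*n (suc Pₛ))) (m∣m*n Pᵤ)
  P : ℕ
  P = _∣_.quotient n∣w+D
  w+D≡P*n : w + D ≡ P * n
  w+D≡P*n = _∣_.equality n∣w+D

∉S-criterion : ∀ h {w D P} → D < N h → w + D ≡ N h * P → 2 * P < 3 * D + 3 * (D % 2) →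
               ¬ (D ≡ 3 + 2 * h × P ≡ 5 + 3 * h) → ¬ InS (N h) (frobenius h) w
∉S-criterion h {D = D} {P} D<N e small _ (inj₁ w∈T) = ∉T-criterion {D₀ = D} {P₀ = P} (s≤s (s≤s z≤n)) D<N e small w∈T
∉S-criterion h D<N e _ ≢F (inj₂ refl) = ≢F (complement-unique D<N (3+2h<N h) e (frobenius-complement h))

InAp-intro : ∀ {n f} t → (∀ w → w + f ≡ fact n t → ¬ InS n f w) → InAp n f (fact n t)
InAp-intro {n} {f} t ∉S = inj₁ (t , refl) , λ f≤s → ∉S (fact n t ∸ f) (m∸n+n≡m f≤s)

-- With i = a + 2 these are ((3n − 5)/2, i − 2, 1) and (3(i − 1), i − 1, 0).
A : ℕ → ℕ → Triple
A h a = (5 + 3 * h , a , 1)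

B : ℕ → Triple
B a = (3 * suc a , suc a , 0)

A∈Ap : ∀ h a → a ≤ h → InAp (N h) (frobenius h) (fact (N h) (A h a))
A∈Ap h a a≤h = InAp-intro (A h a) λ w w+F≡s →
  let P , e , P≡ = complement-of-difference {Dᵤ = 3 + 2 * h} {Pᵤ = 5 + 3 * h} {D = 3 + 2 * a} (s≤s z≤n) w+F≡s
                     (frobenius-complement h) (fact+defect≡n*height (N h) (s≤s z≤n) (A h a)) (D≡ h a)
      P≡4+3a = +-cancelˡ-≡ (5 + 3 * h) P (4 + 3 * a) (trans P≡ (Pₛ≡ h a))
  in ∉S-criterion h 3+2a<N (subst (λ P → w + (3 + 2 * a) ≡ N h * P) P≡4+3a e) small ≢F
  where
  D≡ : ∀ h a → 2 * a + 1 + (5 + 2 * h) ≡ 3 + 2 * h + (3 + 2 * a)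
  D≡ = solve-∀
  Pₛ≡ : ∀ h a → suc (5 + 3 * h + 3 * a + 3 * 1) ≡ 5 + 3 * h + (4 + 3 * a)
  Pₛ≡ = solve-∀
  3+2a<N : 3 + 2 * a < N h
  3+2a<N = ≤-trans (+-monoʳ-≤ 4 (*-monoʳ-≤ 2 a≤h)) (3+2h<N h)
  odd : (3 + 2 * a) % 2 ≡ 1
  odd = trans (cong (_% 2) (identity a)) ([1+2k]%2≡1 (1 + a))
    where identity : ∀ a → 3 + 2 * a ≡ 1 + 2 * (1 + a)
          identity = solve-∀
  small : 2 * (4 + 3 * a) < 3 * (3 + 2 * a) + 3 * ((3 + 2 * a) % 2)
  small = subst (λ e → 2 * (4 + 3 * a) < 3 * (3 + 2 * a) + 3 * e) (sym odd) (m+k≡n⇒m≤n 3 (identity a))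
    where identity : ∀ a → suc (2 * (4 + 3 * a)) + 3 ≡ 3 * (3 + 2 * a) + 3 * 1
          identity = solve-∀
  ≢F : ¬ (3 + 2 * a ≡ 3 + 2 * h × 4 + 3 * a ≡ 5 + 3 * h)
  ≢F (D≡D , P≡P) = 1+n≢n (sym (+-cancelˡ-≡ 4 (3 * h) (1 + 3 * h) (trans (cong (λ k → 4 + 3 * k) (sym a≡h)) P≡P)))
    where a≡h : a ≡ h
          a≡h = *-cancelˡ-≡ a h 2 (+-cancelˡ-≡ 3 _ _ D≡D)

B∈Ap : ∀ h a → a ≤ h → InAp (N h) (frobenius h) (fact (N h) (B a))
B∈Ap h a a≤h = InAp-intro (B a) λ w w+F≡s →
  let P , e , P≡ = complement-of-difference {Dᵤ = 3 + 2 * h} {Pᵤ = 5 + 3 * h} {D = 4 + 2 * a} (s≤s z≤n) w+F≡s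
                     (frobenius-complement h) (fact+defect≡n*height (N h) (s≤s z≤n) (B a)) (D≡ h a)
  in ∉S-criterion h {P = P} 4+2a<N e (≤-trans (small P≡) (m≤m+n _ _)) (≢F {P})
  where
  open ≤-Reasoning
  D≡ : ∀ h a → 2 * suc a + 0 + (5 + 2 * h) ≡ 3 + 2 * h + (4 + 2 * a)
  D≡ = solve-∀
  4+2a<N : 4 + 2 * a < N h
  4+2a<N = +-monoʳ-≤ 5 (*-monoʳ-≤ 2 a≤h)
  small : ∀ {P} → 5 + 3 * h + P ≡ suc (3 * suc a + 3 * suc a + 3 * 0) → 2 * P < 3 * (4 + 2 * a)
  small {P} P≡ = +-cancelʳ-< (10 + 6 * h) (2 * P) _ (begin-strict
    2 * P + (10 + 6 * h)             ≡⟨ identity₁ h P ⟩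
    2 * (5 + 3 * h + P)              ≡⟨ cong (2 *_) P≡ ⟩
    2 * suc (3 * suc a + 3 * suc a + 3 * 0) ≡⟨ identity₂ a ⟩
    14 + 6 * a + 6 * a               ≤⟨ +-monoʳ-≤ (14 + 6 * a) (*-monoʳ-≤ 6 a≤h) ⟩
    14 + 6 * a + 6 * h               <⟨ m+k≡n⇒m≤n 7 (identity₃ h a) ⟩
    3 * (4 + 2 * a) + (10 + 6 * h)   ∎)
    where
    identity₁ : ∀ h P → 2 * P + (10 + 6 * h) ≡ 2 * (5 + 3 * h + P)
    identity₁ = solve-∀
    identity₂ : ∀ a → 2 * suc (3 * suc a + 3 * suc a + 3 * 0) ≡ 14 + 6 * a + 6 * a
    identity₂ = solve-∀
    identity₃ : ∀ h a → suc (14 + 6 * a + 6 * h) + 7 ≡ 3 * (4 + 2 * a) + (10 + 6 * h)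
    identity₃ = solve-∀
  ≢F : ∀ {P} → ¬ (4 + 2 * a ≡ 3 + 2 * h × P ≡ 5 + 3 * h)
  ≢F (D≡D , _) = even≢odd (2 + a) (1 + h) (trans (identity₁ a) (trans D≡D (identity₂ h)))
    where
    identity₁ : ∀ a → 2 * (2 + a) ≡ 4 + 2 * a
    identity₁ = solve-∀
    identity₂ : ∀ h → 3 + 2 * h ≡ suc (2 * (1 + h))
    identity₂ = solve-∀

top-row∉Ap : ∀ h x → ¬ InAp (N h) (frobenius h) (fact (N h) (x , 2 + h , 1))
top-row∉Ap h x (_ , ∉S) = ∉S F≤s (inj₁ ((suc x , 1 , 0) , sym s∸F≡))
  where
  s≡ : fact (N h) (x , 2 + h , 1) ≡ frobenius h + fact (N h) (suc x , 1 , 0)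
  s≡ = trans (fact-N h x (2 + h) 1) (trans (identity h x) (cong (frobenius h +_) (sym (fact-N h (suc x) 1 0))))
    where identity : ∀ h x → x * (5 + 2 * h) + (2 + h) * (13 + 6 * h) + 1 * (14 + 6 * h)
                             ≡ 22 + 23 * h + 6 * (h * h) + (suc x * (5 + 2 * h) + 1 * (13 + 6 * h) + 0 * (14 + 6 * h))
          identity = solve-∀
  F≤s : frobenius h ≤ fact (N h) (x , 2 + h , 1)
  F≤s = subst (frobenius h ≤_) (sym s≡) (m≤m+n _ _)
  s∸F≡ : fact (N h) (x , 2 + h , 1) ∸ frobenius h ≡ fact (N h) (suc x , 1 , 0)
  s∸F≡ = trans (cong (_∸ frobenius h) s≡) (m+n∸m≡n (frobenius h) _)

Trades : ℕ → ℕ → Set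
Trades x y = Σ ℕ λ j → j ≤ y × 3 * j ≤ x

Trades-≡ : ∀ {x y} {w w′ : Trades x y} → proj₁ w ≡ proj₁ w′ → w ≡ w′
Trades-≡ {w = j , j≤y , 3j≤x} {.j , j≤y′ , 3j≤x′} refl = cong₂ (λ p q → j , p , q) (≤-irrelevant j≤y j≤y′) (≤-irrelevant 3j≤x 3j≤x′)

Exchange : ℕ → ℕ → ℕ → Set
Exchange h x z = z ≡ 1 × 5 + 3 * h ≤ x

factorization : ∀ h x y z → Trades x y ⊎ Exchange h x z → Triple
factorization h x y z (inj₁ (j , _)) = (x ∸ 3 * j , y ∸ j , 2 * j + z)
factorization h x y z (inj₂ _)       = (x ∸ (5 + 3 * h) , y + (3 + h) , 0)

factorization-valid : ∀ h x y z w → fact (N h) (factorization h x y z w) ≡ fact (N h) (x , y , z)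
factorization-valid h x y z (inj₁ (j , j≤y , 3j≤x)) = begin
  fact (N h) (x ∸ 3 * j , y ∸ j , 2 * j + z)
    ≡⟨ fact-N h (x ∸ 3 * j) (y ∸ j) (2 * j + z) ⟩
  (x ∸ 3 * j) * N h + (y ∸ j) * (13 + 6 * h) + (2 * j + z) * (14 + 6 * h)
    ≡⟨ trade h (x ∸ 3 * j) (y ∸ j) j z ⟩
  (x ∸ 3 * j + 3 * j) * N h + (y ∸ j + j) * (13 + 6 * h) + z * (14 + 6 * h)
    ≡⟨ cong₂ (λ x′ y′ → x′ * N h + y′ * (13 + 6 * h) + z * (14 + 6 * h)) (m∸n+n≡m 3j≤x) (m∸n+n≡m j≤y) ⟩
  x * N h + y * (13 + 6 * h) + z * (14 + 6 * h)
    ≡⟨ fact-N h x y z ⟨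
  fact (N h) (x , y , z) ∎
  where
  open ≡-Reasoning
  trade : ∀ h p q j z → p * (5 + 2 * h) + q * (13 + 6 * h) + (2 * j + z) * (14 + 6 * h)
                        ≡ (p + 3 * j) * (5 + 2 * h) + (q + j) * (13 + 6 * h) + z * (14 + 6 * h)
  trade = solve-∀
factorization-valid h x y .1 (inj₂ (refl , 5+3h≤x)) = begin
  fact (N h) (x ∸ (5 + 3 * h) , y + (3 + h) , 0)
    ≡⟨ fact-N h (x ∸ (5 + 3 * h)) (y + (3 + h)) 0 ⟩
  (x ∸ (5 + 3 * h)) * N h + (y + (3 + h)) * (13 + 6 * h) + 0 * (14 + 6 * h)
    ≡⟨ exchange h (x ∸ (5 + 3 * h)) y ⟩
  (x ∸ (5 + 3 * h) + (5 + 3 * h)) * N h + y * (13 + 6 * h) + 1 * (14 + 6 * h)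
    ≡⟨ cong (λ x′ → x′ * N h + y * (13 + 6 * h) + 1 * (14 + 6 * h)) (m∸n+n≡m 5+3h≤x) ⟩
  x * N h + y * (13 + 6 * h) + 1 * (14 + 6 * h)
    ≡⟨ fact-N h x y 1 ⟨
  fact (N h) (x , y , 1) ∎
  where
  open ≡-Reasoning
  exchange : ∀ h p y → p * (5 + 2 * h) + (y + (3 + h)) * (13 + 6 * h) + 0 * (14 + 6 * h)
                       ≡ (p + (5 + 3 * h)) * (5 + 2 * h) + y * (13 + 6 * h) + 1 * (14 + 6 * h)
  exchange = solve-∀

factorization-injective : ∀ h x y z {w w′} → factorization h x y z w ≡ factorization h x y z w′ → w ≡ w′
factorization-injective h x y z {inj₁ (j , _)} {inj₁ (j′ , _)} e =
  cong inj₁ (Trades-≡ (*-cancelˡ-≡ j j′ 2 (+-cancelʳ-≡ z _ _ (cong (λ t → proj₂ (proj₂ t)) e))))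
factorization-injective h x y z {inj₁ (j , _)} {inj₂ (refl , _)} e =
  ⊥-elim (1+n≢0 (trans (+-comm 1 (2 * j)) (cong (λ t → proj₂ (proj₂ t)) e)))
factorization-injective h x y z {inj₂ (refl , _)} {inj₁ (j , _)} e =
  ⊥-elim (1+n≢0 (trans (+-comm 1 (2 * j)) (sym (cong (λ t → proj₂ (proj₂ t)) e))))
factorization-injective h x y z {inj₂ (z≡1 , le)} {inj₂ (z≡1′ , le′)} _ =
  cong₂ (λ p q → inj₂ (p , q)) (≡-irrelevant z≡1 z≡1′) (≤-irrelevant le le′)

2q+r≡2y+z⇒q≤y : ∀ {q r y z} → z ≤ 1 → 2 * q + r ≡ 2 * y + z → q ≤ y
2q+r≡2y+z⇒q≤y {q} {r} {y} {z} z≤1 e = s≤s⁻¹ (*-cancelˡ-< 2 q (suc y) (begin-strict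
  2 * q          ≤⟨ m≤m+n (2 * q) r ⟩
  2 * q + r      ≡⟨ e ⟩
  2 * y + z      ≤⟨ +-monoʳ-≤ (2 * y) z≤1 ⟩
  2 * y + 1      <⟨ m+k≡n⇒m≤n 0 (identity y) ⟩
  2 * suc y      ∎))
  where
  open ≤-Reasoning
  identity : ∀ y → suc (2 * y + 1) + 0 ≡ 2 * suc y
  identity = solve-∀

same-coordinates⇒trade : ∀ h {x y z} t → z ≤ 1 → defect t ≡ 2 * y + z → height t ≡ height (x , y , z) →
                         ∃ λ w → factorization h x y z (inj₁ w) ≡ t
same-coordinates⇒trade h {x} {y} {z} (p , q , r) z≤1 D≡ H≡ = (j , j≤y , 3j≤x) , cong₂ _,_ p≡ (cong₂ _,_ q≡ (sym r≡))
  where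
  j = y ∸ q
  q+j≡y : q + j ≡ y
  q+j≡y = m+[n∸m]≡n (2q+r≡2y+z⇒q≤y {q} {r} z≤1 D≡)
  r≡ : r ≡ 2 * j + z
  r≡ = +-cancelˡ-≡ (2 * q) r (2 * j + z) (trans D≡ (trans (cong (λ y′ → 2 * y′ + z) (sym q+j≡y)) (expand q j z)))
    where expand : ∀ q j z → 2 * (q + j) + z ≡ 2 * q + (2 * j + z)
          expand = solve-∀
  p+3j≡x : p + 3 * j ≡ x
  p+3j≡x = +-cancelʳ-≡ (3 * q + 3 * j + 3 * z) (p + 3 * j) x (begin
    p + 3 * j + (3 * q + 3 * j + 3 * z) ≡⟨ expand₁ p q j z ⟩
    p + 3 * q + 3 * (2 * j + z)         ≡⟨ cong (λ r′ → p + 3 * q + 3 * r′) r≡ ⟨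
    p + 3 * q + 3 * r                   ≡⟨ H≡ ⟩
    x + 3 * y + 3 * z                   ≡⟨ cong (λ y′ → x + 3 * y′ + 3 * z) q+j≡y ⟨
    x + 3 * (q + j) + 3 * z             ≡⟨ expand₂ x q j z ⟩
    x + (3 * q + 3 * j + 3 * z)         ∎)
    where
    open ≡-Reasoning
    expand₁ : ∀ p q j z → p + 3 * j + (3 * q + 3 * j + 3 * z) ≡ p + 3 * q + 3 * (2 * j + z)
    expand₁ = solve-∀
    expand₂ : ∀ x q j z → x + 3 * (q + j) + 3 * z ≡ x + (3 * q + 3 * j + 3 * z)
    expand₂ = solve-∀
  j≤y : j ≤ y
  j≤y = subst (j ≤_) q+j≡y (m≤n+m j q)
  3j≤x : 3 * j ≤ x
  3j≤x = subst (3 * j ≤_) p+3j≡x (m≤n+m (3 * j) p)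
  p≡ : x ∸ 3 * j ≡ p
  p≡ = trans (cong (_∸ 3 * j) (sym p+3j≡x)) (m+n∸n≡m p (3 * j))
  q≡ : y ∸ j ≡ q
  q≡ = trans (cong (_∸ j) (sym q+j≡y)) (m+n∸n≡m q j)

excess-equation : ∀ n {x y z} p q r m → height (p , q , r) ≡ height (x , y , z) + m → defect (p , q , r) ≡ 2 * y + z + n * m →
                  2 * x + 3 * z + 2 * m ≡ 2 * p + 3 * r + 3 * (n * m)
excess-equation n {x} {y} {z} p q r m H≡ D≡ = +-cancelˡ-≡ (3 * (2 * y + z)) _ _ (begin
  3 * (2 * y + z) + (2 * x + 3 * z + 2 * m) ≡⟨ expand₁ x y z m ⟩
  2 * (height (x , y , z) + m)              ≡⟨ cong (2 *_) H≡ ⟨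
  2 * height (p , q , r)                    ≡⟨ 2*height≡ p q r ⟩
  2 * p + 3 * (2 * q + r) + 3 * r           ≡⟨ cong (λ d → 2 * p + 3 * d + 3 * r) D≡ ⟩
  2 * p + 3 * (2 * y + z + n * m) + 3 * r   ≡⟨ expand₂ p y z (n * m) r ⟩
  3 * (2 * y + z) + (2 * p + 3 * r + 3 * (n * m)) ∎)
  where
  open ≡-Reasoning
  expand₁ : ∀ x y z m → 3 * (2 * y + z) + (2 * x + 3 * z + 2 * m) ≡ 2 * (x + 3 * y + 3 * z + m)
  expand₁ = solve-∀
  expand₂ : ∀ p y z k r → 2 * p + 3 * (2 * y + z + k) + 3 * r ≡ 3 * (2 * y + z) + (2 * p + 3 * r + 3 * k)
  expand₂ = solve-∀

2x+3z≤ : ∀ h {x z} → x ≤ 6 + 3 * h → z ≤ 1 → 2 * x + 3 * z ≤ 15 + 6 * h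
2x+3z≤ h {x} {z} x≤ z≤1 = ≤-trans (+-mono-≤ (*-monoʳ-≤ 2 x≤) (*-monoʳ-≤ 3 z≤1)) (≤-reflexive (identity h))
  where identity : ∀ h → 2 * (6 + 3 * h) + 3 * 1 ≡ 15 + 6 * h
        identity = solve-∀

-- The left side is at most 3n + 2m, so m = 1 and r = 0; parity then forces z = 1.
excess-forces-exchange : ∀ h {x z p r} m → x ≤ 6 + 3 * h → z ≤ 1 →
                         2 * x + 3 * z + 2 * suc m ≡ 2 * p + 3 * r + 3 * (N h * suc m) →
                         m ≡ 0 × z ≡ 1 × r ≡ 0 × x ≡ p + (5 + 3 * h)
excess-forces-exchange h {x} {z} {p} {r} (suc m) x≤ z≤1 e = ⊥-elim (<⇒≢ (begin-strict
  2 * x + 3 * z + 2 * (2 + m)   ≤⟨ +-monoˡ-≤ (2 * (2 + m)) (2x+3z≤ h x≤ z≤1) ⟩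
  15 + 6 * h + 2 * (2 + m)      <⟨ m+k≡n⇒m≤n (10 + 6 * h + 13 * m + 6 * (h * m)) (identity h m) ⟩
  3 * (N h * (2 + m))           ≤⟨ m≤n+m _ _ ⟩
  2 * p + 3 * r + 3 * (N h * (2 + m)) ∎) e)
  where
  open ≤-Reasoning
  identity : ∀ h m → suc (15 + 6 * h + 2 * (2 + m)) + (10 + 6 * h + 13 * m + 6 * (h * m)) ≡ 3 * ((5 + 2 * h) * (2 + m))
  identity = solve-∀
excess-forces-exchange h {x} {z} {p} {suc r} zero x≤ z≤1 e = ⊥-elim (<⇒≢ (begin-strict
  2 * x + 3 * z + 2 * 1         ≤⟨ +-monoˡ-≤ 2 (2x+3z≤ h x≤ z≤1) ⟩
  15 + 6 * h + 2                <⟨ m+k≡n⇒m≤n 0 (identity h) ⟩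
  3 * 1 + 3 * (N h * 1)         ≤⟨ +-monoˡ-≤ _ (*-monoʳ-≤ 3 (s≤s z≤n)) ⟩
  3 * suc r + 3 * (N h * 1)     ≤⟨ +-monoˡ-≤ _ (m≤n+m _ (2 * p)) ⟩
  2 * p + 3 * suc r + 3 * (N h * 1) ∎) e)
  where
  open ≤-Reasoning
  identity : ∀ h → suc (15 + 6 * h + 2) + 0 ≡ 3 * 1 + 3 * ((5 + 2 * h) * 1)
  identity = solve-∀
excess-forces-exchange h {x} {0} {p} {0} zero _ _ e = ⊥-elim (even≢odd (suc x) (7 + 3 * h + p) (begin
  2 * suc x                     ≡⟨ identity₁ x ⟩
  2 * x + 3 * 0 + 2 * 1         ≡⟨ e ⟩
  2 * p + 3 * 0 + 3 * (N h * 1) ≡⟨ identity₂ h p ⟩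
  suc (2 * (7 + 3 * h + p))     ∎))
  where
  open ≡-Reasoning
  identity₁ : ∀ x → 2 * suc x ≡ 2 * x + 3 * 0 + 2 * 1
  identity₁ = solve-∀
  identity₂ : ∀ h p → 2 * p + 3 * 0 + 3 * ((5 + 2 * h) * 1) ≡ suc (2 * (7 + 3 * h + p))
  identity₂ = solve-∀
excess-forces-exchange h {x} {1} {p} {0} zero _ _ e =
  refl , refl , refl , *-cancelˡ-≡ x _ 2 (+-cancelʳ-≡ 5 _ _ (trans (identity₁ x) (trans e (identity₂ h p))))
  where
  identity₁ : ∀ x → 2 * x + 5 ≡ 2 * x + 3 * 1 + 2 * 1
  identity₁ = solve-∀
  identity₂ : ∀ h p → 2 * p + 3 * 0 + 3 * ((5 + 2 * h) * 1) ≡ 2 * (p + (5 + 3 * h)) + 5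
  identity₂ = solve-∀
excess-forces-exchange h {z = suc (suc _)} zero _ (s≤s ()) _

factorization-surjective : ∀ h {x y z} → z ≤ 1 → x ≤ 6 + 3 * h → 2 * y + z < N h →
                           ∀ t → fact (N h) t ≡ fact (N h) (x , y , z) → ∃ λ w → factorization h x y z w ≡ t
factorization-surjective h {x} {y} {z} z≤1 x≤ D<N (p , q , r) e
  with factorization-lift (s≤s z≤n) D<N (fact+defect≡n*height (N h) (s≤s z≤n) (x , y , z)) (p , q , r) e
... | zero , H≡ , D≡ =
  let w , w↦t = same-coordinates⇒trade h (p , q , r) z≤1 (trans D≡ (m+n*0≡m (2 * y + z) (N h)))
                                       (trans H≡ (+-identityʳ _))
  in inj₁ w , w↦t
... | suc m , H≡ , D≡ with excess-forces-exchange h {p = p} {r = r} m x≤ z≤1 (excess-equation (N h) {x} {y} {z} p q r (suc m) H≡ D≡)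
...   | refl , refl , refl , x≡ = inj₂ (refl , 5+3h≤x) , cong₂ _,_ p≡ (cong (_, 0) q≡)
  where
  5+3h≤x : 5 + 3 * h ≤ x
  5+3h≤x = subst (5 + 3 * h ≤_) (sym x≡) (m≤n+m _ p)
  p≡ : x ∸ (5 + 3 * h) ≡ p
  p≡ = trans (cong (_∸ (5 + 3 * h)) x≡) (m+n∸n≡m p (5 + 3 * h))
  q≡ : y + (3 + h) ≡ q
  q≡ = *-cancelˡ-≡ _ q 2 (sym (trans (sym (+-identityʳ (2 * q))) (trans D≡ (identity h y))))
    where identity : ∀ h y → 2 * y + 1 + (5 + 2 * h) * 1 ≡ 2 * (y + (3 + h))
          identity = solve-∀

Z-≡ : ∀ {n s} {u v : Z n s} → proj₁ u ≡ proj₁ v → u ≡ v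
Z-≡ {u = t , e} {.t , e′} refl = cong (t ,_) (≡-irrelevant e e′)

fibre↔Z : ∀ {W : Set} {n s} (g : W → Triple) → (∀ w → fact n (g w) ≡ s) → (∀ {w w′} → g w ≡ g w′ → w ≡ w′) →
          (∀ t → fact n t ≡ s → ∃ λ w → g w ≡ t) → W ↔ Z n s
fibre↔Z g valid injective surjective = mk↔ₛ′
  (λ w → g w , valid w)
  (λ u → proj₁ (surjective (proj₁ u) (proj₂ u)))
  (λ u → Z-≡ (proj₂ (surjective (proj₁ u) (proj₂ u))))
  (λ w → injective (proj₂ (surjective (g w) (valid w))))

3*≤⇒≤/3 : ∀ {j x} → 3 * j ≤ x → j ≤ x / 3
3*≤⇒≤/3 {j} {x} 3j≤x = subst (_≤ x / 3) (m*n/n≡m j 3) (/-monoˡ-≤ 3 (subst (_≤ x) (*-comm 3 j) 3j≤x))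

≤/3⇒3*≤ : ∀ {j x} → j ≤ x / 3 → 3 * j ≤ x
≤/3⇒3*≤ {x = x} j≤ = ≤-trans (*-monoʳ-≤ 3 j≤) (subst (_≤ x) (*-comm (x / 3) 3) (m/n*n≤m x 3))

Trades↔Fin : ∀ x y → Trades x y ↔ Fin (suc (y ⊓ (x / 3)))
Trades↔Fin x y = mk↔ₛ′ to from (λ i → fromℕ<-toℕ i _) (λ w → Trades-≡ (toℕ-fromℕ< _))
  where
  to : Trades x y → Fin (suc (y ⊓ (x / 3)))
  to (j , j≤y , 3j≤x) = fromℕ< (s≤s (⊓-glb j≤y (3*≤⇒≤/3 3j≤x)))
  from : Fin (suc (y ⊓ (x / 3))) → Trades x y
  from i = toℕ i , ≤-trans i≤ (m⊓n≤m y (x / 3)) , ≤/3⇒3*≤ (≤-trans i≤ (m⊓n≤n y (x / 3)))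
    where i≤ = s≤s⁻¹ (toℕ<n i)

inhabited↔Fin1 : ∀ {P : Set} → (∀ (p q : P) → p ≡ q) → P → P ↔ Fin 1
inhabited↔Fin1 irr p = mk↔ₛ′ (λ _ → zero) (λ _ → p) (λ { zero → refl }) (irr p)

empty↔Fin0 : ∀ {P : Set} → ¬ P → P ↔ Fin 0
empty↔Fin0 ¬p = mk↔ₛ′ (λ p → ⊥-elim (¬p p)) (λ ()) (λ ()) (λ p → ⊥-elim (¬p p))

Fin-cardinality : ∀ {m n} → Fin m ↔ Fin n → m ≡ n
Fin-cardinality m↔n = cantor-schröder-bernstein (Injection.injective (↔⇒↣ m↔n)) (Injection.injective (↔⇒↣ (↔-sym m↔n)))

Exchange-irrelevant : ∀ h x z (e e′ : Exchange h x z) → e ≡ e′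
Exchange-irrelevant h x z (z≡1 , le) (z≡1′ , le′) = cong₂ _,_ (≡-irrelevant z≡1 z≡1′) (≤-irrelevant le le′)

#factorizations : ∀ h {x y z e} → z ≤ 1 → x ≤ 6 + 3 * h → 2 * y + z < N h → Exchange h x z ↔ Fin e →
                  ∀ i → NumFact (N h) (fact (N h) (x , y , z)) i ⇔ (i ≡ suc (y ⊓ (x / 3)) + e)
#factorizations h {x} {y} {z} {e} z≤1 x≤ D<N Exchange↔ i =
  mk⇔ (λ i↔Z → Fin-cardinality (↔-trans i↔Z Z↔)) (λ { refl → ↔-sym Z↔ })
  where
  Z↔ : Z (N h) (fact (N h) (x , y , z)) ↔ Fin (suc (y ⊓ (x / 3)) + e)
  Z↔ = ↔-trans (↔-sym (fibre↔Z (factorization h x y z) (factorization-valid h x y z)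
                                (factorization-injective h x y z) (factorization-surjective h z≤1 x≤ D<N)))
               (↔-trans (Trades↔Fin x y ⊎-↔ Exchange↔) (↔-sym +↔⊎))

/2≡ : ∀ {m} k → m ≡ k * 2 → m / 2 ≡ k
/2≡ k refl = m*n/n≡m k 2

[N+1]/2≡ : ∀ h → (N h + 1) / 2 ≡ 3 + h
[N+1]/2≡ h = /2≡ (3 + h) (identity h)
  where identity : ∀ h → 5 + 2 * h + 1 ≡ (3 + h) * 2
        identity = solve-∀

[N∸1]/2≡ : ∀ h → (N h ∸ 1) / 2 ≡ 2 + h
[N∸1]/2≡ h = /2≡ (2 + h) (identity h)
  where identity : ∀ h → 4 + 2 * h ≡ (2 + h) * 2
        identity = solve-∀

[3N∸1]/2≡ : ∀ h → (3 * N h ∸ 1) / 2 ≡ 7 + 3 * h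
[3N∸1]/2≡ h = /2≡ (7 + 3 * h) (trans (cong (_∸ 1) (split h)) (identity h))
  where
  split : ∀ h → 3 * (5 + 2 * h) ≡ 1 + (14 + 6 * h)
  split = solve-∀
  identity : ∀ h → 14 + 6 * h ≡ (7 + 3 * h) * 2
  identity = solve-∀

[3N∸5]/2≡ : ∀ h → (3 * N h ∸ 5) / 2 ≡ 5 + 3 * h
[3N∸5]/2≡ h = /2≡ (5 + 3 * h) (trans (cong (_∸ 5) (split h)) (identity h))
  where
  split : ∀ h → 3 * (5 + 2 * h) ≡ 5 + (10 + 6 * h)
  split = solve-∀
  identity : ∀ h → 10 + 6 * h ≡ (5 + 3 * h) * 2
  identity = solve-∀

nf-bounds : ∀ h {s x y z} → InAp (N h) (frobenius h) s → IsNF (N h) s (x , y , z) →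
            z ≤ 1 × x ≤ 6 + 3 * h × 2 * y + z < N h
nf-bounds h {x = x} {y} {z} s∈Ap (refl , z<2 , y<[N+1]/2 , x<[3N∸1]/2) = s≤s⁻¹ z<2 , x≤ , D<N z z<2 s∈Ap
  where
  x≤ : x ≤ 6 + 3 * h
  x≤ = s≤s⁻¹ (subst (x <_) ([3N∸1]/2≡ h) x<[3N∸1]/2)
  y≤ : y ≤ 2 + h
  y≤ = s≤s⁻¹ (subst (y <_) ([N+1]/2≡ h) y<[N+1]/2)
  D<N : ∀ z → z < 2 → InAp (N h) (frobenius h) (fact (N h) (x , y , z)) → 2 * y + z < N h
  D<N 0 _ _ = subst (_< N h) (sym (+-identityʳ (2 * y))) (≤-trans (s≤s (*-monoʳ-≤ 2 y≤)) (m+k≡n⇒m≤n 0 (identity h)))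
    where identity : ∀ h → suc (2 * (2 + h)) + 0 ≡ 5 + 2 * h
          identity = solve-∀
  D<N 1 _ s∈Ap with y ≟ 2 + h
  ... | yes refl = ⊥-elim (top-row∉Ap h x s∈Ap)
  ... | no y≢2+h = ≤-trans (s≤s (+-monoˡ-≤ 1 (*-monoʳ-≤ 2 (s≤s⁻¹ (≤∧≢⇒< y≤ y≢2+h))))) (m+k≡n⇒m≤n 1 (identity h))
    where identity : ∀ h → suc (2 * (1 + h) + 1) + 1 ≡ 5 + 2 * h
          identity = solve-∀
  D<N (suc (suc _)) (s≤s (s≤s ())) _

A∈nfM : ∀ h a → a ≤ h → InNfM (N h) (frobenius h) (2 + a) (A h a)
A∈nfM h a a≤h = fact (N h) (A h a) , (A∈Ap h a a≤h , numFact) , (refl , ≤-refl , y< , x<)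
  where
  D<N : 2 * a + 1 < N h
  D<N = ≤-trans (s≤s (+-monoˡ-≤ 1 (*-monoʳ-≤ 2 a≤h))) (m+k≡n⇒m≤n 3 (identity h))
    where identity : ∀ h → suc (2 * h + 1) + 3 ≡ 5 + 2 * h
          identity = solve-∀
  a≤x/3 : a ≤ (5 + 3 * h) / 3
  a≤x/3 = 3*≤⇒≤/3 (≤-trans (*-monoʳ-≤ 3 a≤h) (m≤n+m (3 * h) 5))
  count : 2 + a ≡ suc (a ⊓ ((5 + 3 * h) / 3)) + 1
  count = trans (cong suc (+-comm 1 a)) (cong (λ k → suc k + 1) (sym (m≤n⇒m⊓n≡m a≤x/3)))
  numFact : NumFact (N h) (fact (N h) (A h a)) (2 + a)
  numFact = Equivalence.from (#factorizations h ≤-refl (n≤1+n _) D<N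
              (inhabited↔Fin1 (Exchange-irrelevant h _ 1) (refl , ≤-refl)) (2 + a)) count
  y< : a < (N h + 1) / 2
  y< = subst (a <_) (sym ([N+1]/2≡ h)) (s≤s (≤-trans a≤h (m≤n+m h 2)))
  x< : 5 + 3 * h < (3 * N h ∸ 1) / 2
  x< = subst (5 + 3 * h <_) (sym ([3N∸1]/2≡ h)) (n≤1+n _)

B∈nfM : ∀ h a → a ≤ h → InNfM (N h) (frobenius h) (2 + a) (B a)
B∈nfM h a a≤h = fact (N h) (B a) , (B∈Ap h a a≤h , numFact) , (refl , s≤s z≤n , y< , x<)
  where
  x≤ : 3 * suc a ≤ 6 + 3 * h
  x≤ = ≤-trans (*-monoʳ-≤ 3 (s≤s a≤h)) (m+k≡n⇒m≤n 3 (identity h))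
    where identity : ∀ h → 3 * suc h + 3 ≡ 6 + 3 * h
          identity = solve-∀
  D<N : 2 * suc a + 0 < N h
  D<N = ≤-trans (s≤s (+-monoˡ-≤ 0 (*-monoʳ-≤ 2 (s≤s a≤h)))) (m+k≡n⇒m≤n 2 (identity h))
    where identity : ∀ h → suc (2 * suc h + 0) + 2 ≡ 5 + 2 * h
          identity = solve-∀
  count : 2 + a ≡ suc (suc a ⊓ (3 * suc a / 3)) + 0
  count = sym (trans (+-identityʳ _) (cong suc (trans (cong (suc a ⊓_) (trans (cong (_/ 3) (*-comm 3 (suc a))) (m*n/n≡m (suc a) 3)))
                                                      (⊓-idem (suc a)))))
  numFact : NumFact (N h) (fact (N h) (B a)) (2 + a)
  numFact = Equivalence.from (#factorizations h z≤n x≤ D<N (empty↔Fin0 λ ()) (2 + a)) count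
  y< : suc a < (N h + 1) / 2
  y< = subst (suc a <_) (sym ([N+1]/2≡ h)) (s≤s (s≤s (≤-trans a≤h (n≤1+n h))))
  x< : 3 * suc a < (3 * N h ∸ 1) / 2
  x< = subst (3 * suc a <_) (sym ([3N∸1]/2≡ h)) (s≤s x≤)

nfM-above : ∀ h a t → InNfM (N h) (frobenius h) (2 + a) t → A h a ≤₃ t ⊎ B a ≤₃ t
nfM-above h a (x , y , z) (s , (s∈Ap , i↔Z) , nf@(refl , _)) with nf-bounds h s∈Ap nf
... | z≤1 , x≤ , D<N with z ≟ 1 ×-dec 5 + 3 * h ≤? x
...   | yes ex@(refl , 5+3h≤x) = inj₁ (5+3h≤x , a≤y , ≤-refl)
  where
  count : 2 + a ≡ suc (y ⊓ (x / 3)) + 1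
  count = Equivalence.to (#factorizations h z≤1 x≤ D<N (inhabited↔Fin1 (Exchange-irrelevant h x 1) ex) (2 + a)) i↔Z
  a≤y : a ≤ y
  a≤y = subst (_≤ y) (suc-injective (suc-injective (trans (+-comm 1 _) (sym count)))) (m⊓n≤m y (x / 3))
...   | no ¬ex = inj₂ (≤/3⇒3*≤ (≤-trans k≥ (m⊓n≤n y (x / 3))) , ≤-trans k≥ (m⊓n≤m y (x / 3)) , z≤n)
  where
  count : 2 + a ≡ suc (y ⊓ (x / 3)) + 0
  count = Equivalence.to (#factorizations h z≤1 x≤ D<N (empty↔Fin0 ¬ex) (2 + a)) i↔Z
  k≥ : suc a ≤ y ⊓ (x / 3)
  k≥ = ≤-reflexive (suc-injective (trans count (+-identityʳ _)))

≤₃-trans : ∀ {t u v} → t ≤₃ u → u ≤₃ v → t ≤₃ v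
≤₃-trans (a≤ , b≤ , c≤) (a≤′ , b≤′ , c≤′) = ≤-trans a≤ a≤′ , ≤-trans b≤ b≤′ , ≤-trans c≤ c≤′

≤₃-antisym : ∀ {t u} → t ≤₃ u → u ≤₃ t → t ≡ u
≤₃-antisym (a≤ , b≤ , c≤) (a≥ , b≥ , c≥) = cong₂ _,_ (≤-antisym a≤ a≥) (cong₂ _,_ (≤-antisym b≤ b≥) (≤-antisym c≤ c≥))

minimal-of-two-generators : ∀ {P : Triple → Set} {a b} → P a → P b → ¬ b ≤₃ a → ¬ a ≤₃ b →
                            (∀ t → P t → a ≤₃ t ⊎ b ≤₃ t) → ∀ t → Minimal P t ⇔ (t ≡ a ⊎ t ≡ b)
minimal-of-two-generators {P} {a} {b} Pa Pb b≰a a≰b above t = mk⇔ to from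
  where
  to : Minimal P t → t ≡ a ⊎ t ≡ b
  to (Pt , min) with above t Pt
  ... | inj₁ a≤t = inj₁ (sym (min a Pa a≤t))
  ... | inj₂ b≤t = inj₂ (sym (min b Pb b≤t))
  from : t ≡ a ⊎ t ≡ b → Minimal P t
  from (inj₁ refl) = Pa , λ u Pu u≤a → [ (λ a≤u → ≤₃-antisym u≤a a≤u) , (λ b≤u → ⊥-elim (b≰a (≤₃-trans b≤u u≤a))) ]′ (above u Pu)
  from (inj₂ refl) = Pb , λ u Pu u≤b → [ (λ a≤u → ⊥-elim (a≰b (≤₃-trans a≤u u≤b))) , (λ b≤u → ≤₃-antisym u≤b b≤u) ]′ (above u Pu)

minimal-nfM : ∀ h a → a ≤ h → ∀ t → Minimal (InNfM (N h) (frobenius h) (2 + a)) t ⇔ (t ≡ A h a ⊎ t ≡ B a)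
minimal-nfM h a a≤h = minimal-of-two-generators (A∈nfM h a a≤h) (B∈nfM h a a≤h)
  (λ (_ , 1+a≤a , _) → 1+n≰n 1+a≤a) (λ (_ , _ , 1≤0) → 1+n≰n 1≤0) (nfM-above h a)

odd≥5⇒≡N : ∀ {n} → 5 ≤ n → n % 2 ≡ 1 → ∃ λ h → N h ≡ n
odd≥5⇒≡N {n} 5≤n n-odd = from-half n (n / 2) (trans (m≡m%n+[m/n]*n n 2) (cong (_+ (n / 2) * 2) n-odd)) 5≤n
  where
  from-half : ∀ n k → n ≡ 1 + k * 2 → 5 ≤ n → ∃ λ h → N h ≡ n
  from-half _ 0 refl (s≤s ())
  from-half _ 1 refl (s≤s (s≤s (s≤s ())))
  from-half _ (suc (suc h)) refl _ = h , identity h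
    where identity : ∀ h → 5 + 2 * h ≡ 1 + (2 + h) * 2
          identity = solve-∀

mainTheorem10 : (n : ℕ) → 5 ≤ n → n % 2 ≡ 1 →
    (f : ℕ) → IsFrobeniusT n f →
    (i : ℕ) → 2 ≤ i → i ≤ (n ∸ 1) / 2 →
    (t : Triple) →
    Minimal (InNfM n f i) t ⇔
    (t ≡ ((3 * n ∸ 5) / 2 , i ∸ 2 , 1) ⊎ t ≡ (3 * (i ∸ 1) , i ∸ 1 , 0))
mainTheorem10 n 5≤n n-odd f f-frob (suc (suc a)) (s≤s (s≤s z≤n)) i≤ t with odd≥5⇒≡N 5≤n n-odd
... | h , refl with frobenius-unique h f f-frob
...   | refl = subst (λ c → Minimal (InNfM (N h) (frobenius h) (2 + a)) t ⇔ (t ≡ (c , a , 1) ⊎ t ≡ B a))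
                     (sym ([3N∸5]/2≡ h)) (minimal-nfM h a a≤h t)
  where
  a≤h : a ≤ h
  a≤h = s≤s⁻¹ (s≤s⁻¹ (subst (2 + a ≤_) ([N∸1]/2≡ h) i≤))
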